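{- Let $F$ be a field of characteristic zero, $f$ an anti-involution of $F^\times$, and $\Phi_f(P_n)=(P_n,F^\times,\varphi,f)$ a skew gain graph whose underlying graph is the path $P_n$ on $n$ vertices. Then $$\Psi(\Phi_f(P_n),x)=x^n+\sum_{k=1}^{\lfloor n/2\rfloor}(-1)^k a_{2k}x^{n-2k},\qquad a_{2k}=\sum_{M\in\mathcal{M}_k(P_n)}\prod_{e\in M}g(\varphi(e)).$$
   Context: An anti-involution of $F^\times$ is a map $f:F^\times\to F^\times$ with $f(f(x))=x$ and $f(xy)=f(y)f(x)$. A skew gain graph $(G,F^\times,\varphi,f)$ is a simple graph $G$ with vertices $v_1,\dots,v_n$ and a function $\varphi$ on oriented edges (both orientations of each edge) with values in $F^\times$ satisfying $\varphi(\overrightarrow{vu})=f(\varphi(\overrightarrow{uv}))$. Its adjacency matrix $A$ has $(i,j)$ entry $\varphi(\overrightarrow{v_iv_j})$ if $v_i\sim v_j$ and $0$ otherwise, and $\Psi(\cdot,x)=\det(xI-A)$. $g(x)=xf(x)$, and for an edge $e=uv$, $g(\varphi(e))$ means $g(\varphi(\overrightarrow{uv}))$, which equals $g(\varphi(\overrightarrow{vu}))$. $\mathcal{M}_k(G)$ is the set of matchings of $G$ with exactly $k$ edges. -}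

module Defs where

open import Level using (Level; _⊔_) renaming (suc to lsuc)
open import Data.Nat as ℕ using (ℕ; zero; suc; _∸_; ⌊_/2⌋)
open import Data.Fin as Fin using (Fin; zero; suc; toℕ; inject₁; punchIn)
open import Data.Fin.Properties using (_≟_)
open import Data.Bool using (Bool; true; false; if_then_else_; _∧_; _∨_; not)
open import Data.List as List using (List; []; _∷_; map; foldr; length; allFin)
open import Data.Product using (_×_; _,_; proj₁; proj₂; ∃)
open import Relation.Nullary using (¬_)
open import Relation.Nullary.Decidable using (⌊_⌋)
import Algebra.Bundles
open Algebra.Bundles using (CommutativeRing)
import Algebra.Definitions.RawSemiring as RS

record Field (c ℓ : Level) : Set (lsuc (c ⊔ ℓ)) where
  field
    commutativeRing : CommutativeRing c ℓ
  open CommutativeRing commutativeRing public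
  field
    0≉1     : ¬ (0# ≈ 1#)
    inverse : ∀ x → ¬ (x ≈ 0#) → ∃ λ y → x * y ≈ 1#

module FieldOps {c ℓ : Level} (F : Field c ℓ) where
  open Field F using (Carrier; _≈_; _+_; _*_; -_; 0#; 1#; semiring)
  open RS (Algebra.Bundles.Semiring.rawSemiring semiring) public using (_^_) renaming (_×_ to _·ℕ_)

  CharZero : Set ℓ
  CharZero = ∀ (n : ℕ) → ¬ (suc n ·ℕ 1# ≈ 0#)

  -- We represent it
  -- by a function on the carrier whose behaviour is only constrained on
  -- nonzero elements (its values at 0 are irrelevant).
  record AntiInvolution : Set (c ⊔ ℓ) where
    field
      fun      : Carrier → Carrier
      cong     : ∀ {x y} → ¬ (x ≈ 0#) → x ≈ y → fun x ≈ fun y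
      nonzero  : ∀ x → ¬ (x ≈ 0#) → ¬ (fun x ≈ 0#)
      involut  : ∀ x → ¬ (x ≈ 0#) → fun (fun x) ≈ x
      anti     : ∀ x y → ¬ (x ≈ 0#) → ¬ (y ≈ 0#) → fun (x * y) ≈ fun y * fun x

  Σ-list : List Carrier → Carrier
  Σ-list = foldr _+_ 0#

  Π-list : List Carrier → Carrier
  Π-list = foldr _*_ 1#

  det : ∀ n → (Fin n → Fin n → Carrier) → Carrier
  det zero    M = 1#
  det (suc n) M =
    Σ-list (map (λ j → ((- 1#) ^ toℕ j) * (M zero j *
                        det n (λ i k → M (suc i) (punchIn j k))))
                (allFin (suc n)))

pathEdges : ∀ n → List (Fin n × Fin n)
pathEdges zero    = []
pathEdges (suc m) = map (λ i → inject₁ i , suc i) (allFin m)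

_==_ : ∀ {n} → Fin n → Fin n → Bool
i == j = ⌊ i ≟ j ⌋

anyB : ∀ {A : Set} → (A → Bool) → List A → Bool
anyB p = foldr (λ a b → p a ∨ b) false

allB : ∀ {A : Set} → (A → Bool) → List A → Bool
allB p = foldr (λ a b → p a ∧ b) true

adjacent : ∀ {n} → Fin n → Fin n → Bool
adjacent {n} i j = anyB (λ e → (proj₁ e == i ∧ proj₂ e == j) ∨
                               (proj₁ e == j ∧ proj₂ e == i)) (pathEdges n)

-- all sublists (= all subsets of the edge list, which has no duplicates)
sublists : ∀ {A : Set} → List A → List (List A)
sublists []       = [] ∷ []
sublists (a ∷ as) = let r = sublists as in r List.++ map (a ∷_) r

disjointEdges : ∀ {n} → Fin n × Fin n → Fin n × Fin n → Bool
disjointEdges (a , b) (c , d) =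
  not (a == c ∨ a == d ∨ b == c ∨ b == d)

isMatching : ∀ {n} → List (Fin n × Fin n) → Bool
isMatching []       = true
isMatching (e ∷ es) = allB (disjointEdges e) es ∧ isMatching es

matchings : ∀ n → ℕ → List (List (Fin n × Fin n))
matchings n k = List.filterᵇ (λ M → isMatching M ∧ (length M ℕ.≡ᵇ k))
                             (sublists (pathEdges n))

module SkewGain {c ℓ : Level} (F : Field c ℓ) where
  open Field F using (Carrier; _≈_; _+_; _*_; -_; _-_; 0#; 1#)
  open FieldOps F

  adjMatrix : ∀ n → (Fin n → Fin n → Carrier) → Fin n → Fin n → Carrier
  adjMatrix n φ i j = if adjacent i j then φ i j else 0#

  Ψ : ∀ n → (Fin n → Fin n → Carrier) → Carrier → Carrier
  Ψ n φ x = det n (λ i j → (if i == j then x else 0#) - adjMatrix n φ i j)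

  a₂ : AntiInvolution → ∀ n → (Fin n → Fin n → Carrier) → ℕ → Carrier
  a₂ f n φ k = Σ-list (map (λ M → Π-list (map (λ e → g (φ (proj₁ e) (proj₂ e))) M))
                           (matchings n k))
    where g : Carrier → Carrier
          g y = y * AntiInvolution.fun f y

  rhs : AntiInvolution → ∀ n → (Fin n → Fin n → Carrier) → Carrier → Carrier
  rhs f n φ x = x ^ n + Σ-list (map (λ k → ((- 1#) ^ k) * (a₂ f n φ k * x ^ (n ∸ 2 ℕ.* k)))
                                    (List.map suc (List.upTo ⌊ n /2⌋)))

module Submission where

-- Expanding det(xI − A) along its first row shows that the characteristic polynomial
-- of a weighted path obeys the continuant recurrence
--   Ψ(P_{m+2}) = x Ψ(P_{m+1}) − φ(v₁v₂) φ(v₂v₁) Ψ(P_m),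
-- where the smaller paths are obtained by deleting v₁, resp. v₁ and v₂.  Splitting the
-- matchings of P_{m+2} by whether they contain the edge v₁v₂ shows that the signed
-- matching sum Σ_M (−1)^|M| Π_{e∈M} w(e) x^(n−2|M|) obeys the same recurrence when
-- w(v_i v_j) = φ(v_i v_j) φ(v_j v_i), which the skew condition turns into g(φ(e)).
-- Grouping the matchings by size then yields the coefficients a_{2k}.

open import Defs
open import Level using (Level)
open import Data.Nat as ℕ using (ℕ; zero; suc; _≤_; _<_; _≡ᵇ_; _∸_; z≤n; s≤s; ⌊_/2⌋)
import Data.Nat.Properties as ℕₚ
open import Data.Nat.Properties using (+-∸-assoc; *-suc; ⌊n/2⌋-mono; n≡⌊n+n/2⌋; m≤n⇒m≤1+n)
open import Data.Fin using (Fin; zero; suc; toℕ; punchIn)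
open import Data.Fin.Properties using (_≟_)
open import Data.Bool using (Bool; true; false; T; _∧_; _∨_; if_then_else_)
open import Data.Bool.Properties using (∧-zeroʳ; ∨-identityʳ)
open import Data.List using (List; []; _∷_; _++_; map; length; filterᵇ; upTo; allFin)
open import Data.List.Properties using (filter-++; map-++; map-∘; length-map; map-tabulate; map-applyUpTo; ++-identityʳ)
open import Data.List.Relation.Unary.All as All using (All; []; _∷_)
open import Data.List.Relation.Unary.All.Properties using (++⁺; map⁺; all-filter; tabulate⁺)
open import Data.Product using (_×_; _,_; proj₁; proj₂)
open import Function using (_∘_; id)
open import Relation.Nullary using (¬_; yes; no)
open import Data.Unit using (tt)
open import Relation.Nullary.Decidable using (T?)
open import Relation.Binary.PropositionalEquality as ≡ using (_≡_; refl; cong; cong₂)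

-- Lists and Boolean folds

filterᵇ-map : ∀ {A B : Set} (p : B → Bool) (f : A → B) xs →
  filterᵇ p (map f xs) ≡ map f (filterᵇ (p ∘ f) xs)
filterᵇ-map p f [] = refl
filterᵇ-map p f (x ∷ xs) with p (f x)
... | true  = cong (f x ∷_) (filterᵇ-map p f xs)
... | false = filterᵇ-map p f xs

filterᵇ-cong : ∀ {A : Set} {p q : A → Bool} → (∀ x → p x ≡ q x) → ∀ xs →
  filterᵇ p xs ≡ filterᵇ q xs
filterᵇ-cong p≗q [] = refl
filterᵇ-cong {p = p} {q} p≗q (x ∷ xs) with p x | q x | p≗q x
... | true  | true  | _ = cong (x ∷_) (filterᵇ-cong p≗q xs)
... | false | false | _ = filterᵇ-cong p≗q xs

filterᵇ-false : ∀ {A : Set} (xs : List A) → filterᵇ (λ _ → false) xs ≡ []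
filterᵇ-false [] = refl
filterᵇ-false (x ∷ xs) = filterᵇ-false xs

filterᵇ-∧ : ∀ {A : Set} (p q : A → Bool) xs →
  filterᵇ (λ x → p x ∧ q x) xs ≡ filterᵇ q (filterᵇ p xs)
filterᵇ-∧ p q [] = refl
filterᵇ-∧ p q (x ∷ xs) with p x
... | false = filterᵇ-∧ p q xs
... | true with q x
...   | true  = cong (x ∷_) (filterᵇ-∧ p q xs)
...   | false = filterᵇ-∧ p q xs

sublists-map : ∀ {A B : Set} (f : A → B) xs → sublists (map f xs) ≡ map (map f) (sublists xs)
sublists-map f [] = refl
sublists-map f (x ∷ xs) rewrite sublists-map f xs =
  ≡.sym (≡.trans (map-++ (map f) (sublists xs) _)
                 (cong (map (map f) (sublists xs) ++_)
                   (≡.trans (≡.sym (map-∘ (sublists xs))) (map-∘ (sublists xs)))))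

filterᵇ-sublists-∷ : ∀ {A : Set} (p : List A → Bool) x xs →
  filterᵇ p (sublists (x ∷ xs)) ≡
  filterᵇ p (sublists xs) ++ map (x ∷_) (filterᵇ (p ∘ (x ∷_)) (sublists xs))
filterᵇ-sublists-∷ p x xs =
  ≡.trans (filter-++ (T? ∘ p) (sublists xs) _) (cong (filterᵇ p (sublists xs) ++_) (filterᵇ-map p (x ∷_) (sublists xs)))

anyB-map : ∀ {A B : Set} (p : B → Bool) (f : A → B) xs → anyB p (map f xs) ≡ anyB (p ∘ f) xs
anyB-map p f [] = refl
anyB-map p f (x ∷ xs) = cong (p (f x) ∨_) (anyB-map p f xs)

anyB-cong : ∀ {A : Set} {p q : A → Bool} → (∀ x → p x ≡ q x) → ∀ xs → anyB p xs ≡ anyB q xs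
anyB-cong p≗q [] = refl
anyB-cong p≗q (x ∷ xs) = cong₂ _∨_ (p≗q x) (anyB-cong p≗q xs)

anyB-false : ∀ {A : Set} {p : A → Bool} → (∀ x → p x ≡ false) → ∀ xs → anyB p xs ≡ false
anyB-false p≡false [] = refl
anyB-false p≡false (x ∷ xs) rewrite p≡false x = anyB-false p≡false xs

allB-map : ∀ {A B : Set} (p : B → Bool) (f : A → B) xs → allB p (map f xs) ≡ allB (p ∘ f) xs
allB-map p f [] = refl
allB-map p f (x ∷ xs) = cong (p (f x) ∧_) (allB-map p f xs)

allB-cong : ∀ {A : Set} {p q : A → Bool} → (∀ x → p x ≡ q x) → ∀ xs → allB p xs ≡ allB q xs
allB-cong p≗q [] = refl
allB-cong p≗q (x ∷ xs) = cong₂ _∧_ (p≗q x) (allB-cong p≗q xs)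

allB-true : ∀ {A : Set} {p : A → Bool} → (∀ x → p x ≡ true) → ∀ xs → allB p xs ≡ true
allB-true p≡true [] = refl
allB-true p≡true (x ∷ xs) rewrite p≡true x = allB-true p≡true xs

upTo-suc : ∀ N → upTo (suc N) ≡ 0 ∷ map suc (upTo N)
upTo-suc N = cong (0 ∷_) (≡.sym (map-applyUpTo id suc N))

2*m≤n⇒m≤⌊n/2⌋ : ∀ {m n} → 2 ℕ.* m ≤ n → m ≤ ⌊ n /2⌋
2*m≤n⇒m≤⌊n/2⌋ {m} {n} 2m≤n =
  ≡.subst (_≤ ⌊ n /2⌋) (≡.sym (n≡⌊n+n/2⌋ m))
          (⌊n/2⌋-mono (≡.subst (_≤ n) (cong (m ℕ.+_) (ℕₚ.+-identityʳ m)) 2m≤n))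

-- The path P_n: adjacency and matchings

shiftEdge : ∀ {n} → Fin n × Fin n → Fin (suc n) × Fin (suc n)
shiftEdge (i , j) = suc i , suc j

edge₀₁ : ∀ {m} → Fin (suc (suc m)) × Fin (suc (suc m))
edge₀₁ = zero , suc zero

minor₀₀ : ∀ {a} {A : Set a} {n} → (Fin (suc n) → Fin (suc n) → A) → Fin n → Fin n → A
minor₀₀ M i j = M (suc i) (suc j)

pathEdges-suc-suc : ∀ m → pathEdges (suc (suc m)) ≡ edge₀₁ ∷ map shiftEdge (pathEdges (suc m))
pathEdges-suc-suc m =
  cong (edge₀₁ ∷_) (≡.trans (map-tabulate suc _) (≡.sym (≡.trans (≡.sym (map-∘ (allFin m))) (map-tabulate id _))))

-- `suc i ≟ suc j` is computed through `map′`, so `suc i == suc j` does not reduce to `i == j`.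
==-suc : ∀ {n} (i j : Fin n) → (suc i == suc j) ≡ (i == j)
==-suc i j with i ≟ j
... | yes _ = refl
... | no _  = refl

joins : ∀ {n} → Fin n → Fin n → Fin n × Fin n → Bool
joins i j e = (proj₁ e == i ∧ proj₂ e == j) ∨ (proj₁ e == j ∧ proj₂ e == i)

joins-shiftEdge : ∀ {n} (i j : Fin n) e → joins (suc i) (suc j) (shiftEdge e) ≡ joins i j e
joins-shiftEdge i j (a , b) rewrite ==-suc a i | ==-suc a j | ==-suc b i | ==-suc b j = refl

adjacent-suc-suc : ∀ m (i j : Fin (suc (suc m))) →
  adjacent i j ≡ joins i j edge₀₁ ∨ anyB (joins i j ∘ shiftEdge) (pathEdges (suc m))
adjacent-suc-suc m i j =
  ≡.trans (cong (anyB (joins i j)) (pathEdges-suc-suc m))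
          (cong (joins i j edge₀₁ ∨_) (anyB-map (joins i j) shiftEdge (pathEdges (suc m))))

adjacent-suc : ∀ {n} (i j : Fin n) → adjacent (suc i) (suc j) ≡ adjacent i j
adjacent-suc {suc m} i j =
  ≡.trans (adjacent-suc-suc m (suc i) (suc j)) (anyB-cong (joins-shiftEdge i j) (pathEdges (suc m)))

adjacent-zero-zero : ∀ m → adjacent {suc (suc m)} zero zero ≡ false
adjacent-zero-zero m = ≡.trans (adjacent-suc-suc m zero zero) (anyB-false (λ _ → refl) (pathEdges (suc m)))

adjacent-zero-suc-suc : ∀ m (j : Fin m) → adjacent {suc (suc m)} zero (suc (suc j)) ≡ false
adjacent-zero-suc-suc m j =
  ≡.trans (adjacent-suc-suc m zero (suc (suc j)))
          (anyB-false {p = joins zero (suc (suc j)) ∘ shiftEdge} (λ _ → ∧-zeroʳ _) (pathEdges (suc m)))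

adjacent-suc-suc-zero : ∀ m (i : Fin m) → adjacent {suc (suc m)} (suc (suc i)) zero ≡ false
adjacent-suc-suc-zero m i =
  ≡.trans (adjacent-suc-suc m (suc (suc i)) zero)
          (anyB-false {p = joins (suc (suc i)) zero ∘ shiftEdge}
                      (λ _ → ≡.trans (∨-identityʳ _) (∧-zeroʳ _)) (pathEdges (suc m)))

disjointEdges-shiftEdge : ∀ {n} (e e′ : Fin n × Fin n) →
  disjointEdges (shiftEdge e) (shiftEdge e′) ≡ disjointEdges e e′
disjointEdges-shiftEdge (a , b) (c , d) rewrite ==-suc a c | ==-suc a d | ==-suc b c | ==-suc b d = refl

isMatching-shiftEdge : ∀ {n} (M : List (Fin n × Fin n)) → isMatching (map shiftEdge M) ≡ isMatching M
isMatching-shiftEdge [] = refl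
isMatching-shiftEdge (e ∷ M) =
  cong₂ _∧_ (≡.trans (allB-map _ shiftEdge M) (allB-cong (disjointEdges-shiftEdge e) M)) (isMatching-shiftEdge M)

allMatchings : ∀ n → List (List (Fin n × Fin n))
allMatchings n = filterᵇ isMatching (sublists (pathEdges n))

matchings-shiftEdge : ∀ {n} (E : List (Fin n × Fin n)) →
  filterᵇ isMatching (sublists (map shiftEdge E)) ≡ map (map shiftEdge) (filterᵇ isMatching (sublists E))
matchings-shiftEdge E =
  ≡.trans (cong (filterᵇ isMatching) (sublists-map shiftEdge E))
    (≡.trans (filterᵇ-map isMatching (map shiftEdge) (sublists E))
             (cong (map (map shiftEdge)) (filterᵇ-cong isMatching-shiftEdge (sublists E))))

matchings-avoiding-vertex₀ : ∀ m →
  filterᵇ (λ M → isMatching (edge₀₁ ∷ map shiftEdge M)) (sublists (pathEdges (suc m)))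
  ≡ map (map shiftEdge) (allMatchings m)
matchings-avoiding-vertex₀ zero = refl
matchings-avoiding-vertex₀ (suc m) =
  ≡.trans (cong (filterᵇ extends ∘ sublists) (pathEdges-suc-suc m))
    (≡.trans (filterᵇ-sublists-∷ extends edge₀₁ E)
      (≡.trans (cong₂ _++_ avoiding (cong (map (edge₀₁ ∷_)) (filterᵇ-false (sublists E))))
               (++-identityʳ _)))
  where
    E : List (Fin (suc (suc m)) × Fin (suc (suc m)))
    E = map shiftEdge (pathEdges (suc m))
    extends : List (Fin (suc (suc m)) × Fin (suc (suc m))) → Bool
    extends M = isMatching (edge₀₁ ∷ map shiftEdge M)
    extends-shift : ∀ M → extends (map shiftEdge M) ≡ isMatching M
    extends-shift M = cong₂ _∧_
      (≡.trans (allB-map _ shiftEdge (map shiftEdge M))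
        (≡.trans (allB-map _ shiftEdge M) (allB-true (λ _ → refl) M)))
      (≡.trans (isMatching-shiftEdge (map shiftEdge M)) (isMatching-shiftEdge M))
    avoiding : filterᵇ extends (sublists E) ≡ map (map shiftEdge) (allMatchings (suc m))
    avoiding =
      ≡.trans (cong (filterᵇ extends) (sublists-map shiftEdge (pathEdges (suc m))))
        (≡.trans (filterᵇ-map extends (map shiftEdge) (sublists (pathEdges (suc m))))
                 (cong (map (map shiftEdge)) (filterᵇ-cong extends-shift (sublists (pathEdges (suc m))))))

allMatchings-suc-suc : ∀ m → allMatchings (suc (suc m)) ≡
  map (map shiftEdge) (allMatchings (suc m)) ++
  map (edge₀₁ ∷_) (map (map shiftEdge) (map (map shiftEdge) (allMatchings m)))
allMatchings-suc-suc m =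
  ≡.trans (cong (filterᵇ isMatching ∘ sublists) (pathEdges-suc-suc m))
    (≡.trans (filterᵇ-sublists-∷ isMatching edge₀₁ (map shiftEdge E))
      (cong₂ _++_ (matchings-shiftEdge E)
        (cong (map (edge₀₁ ∷_))
          (≡.trans (cong (filterᵇ _) (sublists-map shiftEdge E))
            (≡.trans (filterᵇ-map _ (map shiftEdge) (sublists E))
                     (cong (map (map shiftEdge)) (matchings-avoiding-vertex₀ m)))))))
  where
    E : List (Fin (suc m) × Fin (suc m))
    E = pathEdges (suc m)

allMatchings-size-bound : ∀ n → All (λ M → 2 ℕ.* length M ≤ n) (allMatchings n)
allMatchings-size-bound zero = z≤n ∷ []
allMatchings-size-bound (suc zero) = z≤n ∷ []
allMatchings-size-bound (suc (suc m)) =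
  ≡.subst (All (λ M → 2 ℕ.* length M ≤ suc (suc m))) (≡.sym (allMatchings-suc-suc m))
    (++⁺ (map⁺ (All.map (λ {M} le → without-edge₀₁ M le) (allMatchings-size-bound (suc m))))
         (map⁺ (map⁺ (map⁺ (All.map (λ {M} le → with-edge₀₁ M le) (allMatchings-size-bound m))))))
  where
    without-edge₀₁ : ∀ {n} (M : List (Fin n × Fin n)) →
      2 ℕ.* length M ≤ suc m → 2 ℕ.* length (map shiftEdge M) ≤ suc (suc m)
    without-edge₀₁ M le rewrite length-map shiftEdge M = m≤n⇒m≤1+n le
    with-edge₀₁ : ∀ {n} (M : List (Fin n × Fin n)) → 2 ℕ.* length M ≤ m →
      2 ℕ.* length (edge₀₁ {n} ∷ map shiftEdge (map shiftEdge M)) ≤ suc (suc m)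
    with-edge₀₁ M le rewrite length-map shiftEdge (map shiftEdge M) | length-map shiftEdge M | *-suc 2 (length M) =
      s≤s (s≤s le)

filterᵇ-size-map-shiftEdge : ∀ {n} k (L : List (List (Fin n × Fin n))) →
  filterᵇ (λ M → length M ≡ᵇ k) (map (map shiftEdge) L) ≡ map (map shiftEdge) (filterᵇ (λ M → length M ≡ᵇ k) L)
filterᵇ-size-map-shiftEdge k L =
  ≡.trans (filterᵇ-map (λ M → length M ≡ᵇ k) (map shiftEdge) L)
          (cong (map (map shiftEdge)) (filterᵇ-cong (λ M → cong (_≡ᵇ k) (length-map shiftEdge M)) L))

allMatchings-size-zero : ∀ n → filterᵇ (λ M → length M ≡ᵇ 0) (allMatchings n) ≡ [] ∷ []
allMatchings-size-zero zero = refl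
allMatchings-size-zero (suc zero) = refl
allMatchings-size-zero (suc (suc m)) =
  ≡.trans (cong (filterᵇ empty) (allMatchings-suc-suc m))
    (≡.trans (filter-++ (T? ∘ empty) (map (map shiftEdge) (allMatchings (suc m))) with-edge₀₁)
      (≡.trans (cong₂ _++_ (≡.trans (filterᵇ-size-map-shiftEdge 0 (allMatchings (suc m)))
                                    (cong (map (map shiftEdge)) (allMatchings-size-zero (suc m))))
                           (≡.trans (filterᵇ-map empty (edge₀₁ ∷_) shifted)
                                    (cong (map (edge₀₁ ∷_)) (filterᵇ-false shifted))))
               (++-identityʳ _)))
  where
    empty : ∀ {n} → List (Fin n × Fin n) → Bool
    empty M = length M ≡ᵇ 0
    shifted with-edge₀₁ : List (List (Fin (suc (suc m)) × Fin (suc (suc m))))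
    shifted = map (map shiftEdge) (map (map shiftEdge) (allMatchings m))
    with-edge₀₁ = map (edge₀₁ ∷_) shifted

-- Sums and determinants over a field

module _ {c ℓ : Level} (F : Field c ℓ) where
  open Field F hiding (zero) renaming (refl to ≈-refl; sym to ≈-sym; trans to ≈-trans; reflexive to ≈-reflexive)
  open FieldOps F
  open import Algebra.Properties.CommutativeSemigroup *-commutativeSemigroup using (x∙yz≈y∙xz)
  open import Algebra.Properties.CommutativeSemigroup +-commutativeSemigroup using () renaming (interchange to +-interchange)
  open import Algebra.Properties.Ring ring using (-‿distribˡ-*; -‿distribʳ-*; -0#≈0#; -1*x≈-x; -‿involutive)
  open import Relation.Binary.Reasoning.Setoid setoid

  Σ-map-++ : ∀ {A : Set} (f : A → Carrier) xs ys →
    Σ-list (map f (xs ++ ys)) ≈ Σ-list (map f xs) + Σ-list (map f ys)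
  Σ-map-++ f [] ys = ≈-sym (+-identityˡ _)
  Σ-map-++ f (x ∷ xs) ys = ≈-trans (+-cong ≈-refl (Σ-map-++ f xs ys)) (≈-sym (+-assoc _ _ _))

  Σ-map : ∀ {A B : Set} (f : B → Carrier) (g : A → B) xs → Σ-list (map f (map g xs)) ≡ Σ-list (map (f ∘ g) xs)
  Σ-map f g xs = cong Σ-list (≡.sym (map-∘ xs))

  Σ-congᴬ : ∀ {A : Set} {f g : A → Carrier} {xs} → All (λ a → f a ≈ g a) xs → Σ-list (map f xs) ≈ Σ-list (map g xs)
  Σ-congᴬ [] = ≈-refl
  Σ-congᴬ (fx≈gx ∷ f≈g) = +-cong fx≈gx (Σ-congᴬ f≈g)

  Σ-cong : ∀ {A : Set} {f g : A → Carrier} → (∀ a → f a ≈ g a) → ∀ xs → Σ-list (map f xs) ≈ Σ-list (map g xs)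
  Σ-cong f≈g xs = Σ-congᴬ (All.universal f≈g xs)

  Σ-zero : ∀ {A : Set} {f : A → Carrier} {xs} → All (λ a → f a ≈ 0#) xs → Σ-list (map f xs) ≈ 0#
  Σ-zero [] = ≈-refl
  Σ-zero (fx≈0 ∷ f≈0) = ≈-trans (+-cong fx≈0 (Σ-zero f≈0)) (+-identityˡ 0#)

  Σ-*ˡ : ∀ {A : Set} a (f : A → Carrier) xs → Σ-list (map (λ x → a * f x) xs) ≈ a * Σ-list (map f xs)
  Σ-*ˡ a f [] = ≈-sym (zeroʳ a)
  Σ-*ˡ a f (x ∷ xs) = ≈-trans (+-cong ≈-refl (Σ-*ˡ a f xs)) (≈-sym (distribˡ a _ _))

  Σ-*ʳ : ∀ {A : Set} a (f : A → Carrier) xs → Σ-list (map (λ x → f x * a) xs) ≈ Σ-list (map f xs) * a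
  Σ-*ʳ a f [] = ≈-sym (zeroˡ a)
  Σ-*ʳ a f (x ∷ xs) = ≈-trans (+-cong ≈-refl (Σ-*ʳ a f xs)) (≈-sym (distribʳ a _ _))

  Σ-+ : ∀ {A : Set} (f g : A → Carrier) xs →
    Σ-list (map (λ x → f x + g x) xs) ≈ Σ-list (map f xs) + Σ-list (map g xs)
  Σ-+ f g [] = ≈-sym (+-identityˡ 0#)
  Σ-+ f g (x ∷ xs) = ≈-trans (+-cong ≈-refl (Σ-+ f g xs)) (+-interchange _ _ _ _)

  Σ-filterᵇ-∷ : ∀ {A : Set} (p : A → Bool) (f : A → Carrier) x xs →
    Σ-list (map f (filterᵇ p (x ∷ xs))) ≈ (if p x then f x else 0#) + Σ-list (map f (filterᵇ p xs))
  Σ-filterᵇ-∷ p f x xs with p x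
  ... | true  = ≈-refl
  ... | false = ≈-sym (+-identityˡ _)

  Σ-indicator : ∀ j {N} c → j < N → Σ-list (map (λ k → if j ≡ᵇ k then c else 0#) (upTo N)) ≈ c
  Σ-indicator j {suc N} c j<N = begin
    Σ-list (map (indicator j) (upTo (suc N)))                    ≡⟨ cong (Σ-list ∘ map (indicator j)) (upTo-suc N) ⟩
    indicator j 0 + Σ-list (map (indicator j) (map suc (upTo N))) ≡⟨ cong (indicator j 0 +_) (Σ-map (indicator j) suc (upTo N)) ⟩
    indicator j 0 + Σ-list (map (indicator j ∘ suc) (upTo N))    ≈⟨ split j j<N ⟩
    c                                                            ∎
    where
      indicator : ℕ → ℕ → Carrier
      indicator j k = if j ≡ᵇ k then c else 0#
      split : ∀ j → j < suc N → indicator j 0 + Σ-list (map (indicator j ∘ suc) (upTo N)) ≈ c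
      split zero _ = ≈-trans (+-cong ≈-refl (Σ-zero (All.universal (λ _ → ≈-refl) (upTo N)))) (+-identityʳ c)
      split (suc j) (s≤s j<N) = ≈-trans (+-identityˡ _) (Σ-indicator j c j<N)

  Σ-groupBy : ∀ {A : Set} (κ : A → ℕ) (f : A → Carrier) {N} xs → All (λ a → κ a < N) xs →
    Σ-list (map f xs) ≈ Σ-list (map (λ k → Σ-list (map f (filterᵇ (λ a → κ a ≡ᵇ k) xs))) (upTo N))
  Σ-groupBy κ f {N} [] [] = ≈-sym (Σ-zero (All.universal (λ _ → ≈-refl) (upTo N)))
  Σ-groupBy κ f {N} (x ∷ xs) (κx<N ∷ κ<N) = ≈-sym (begin
    Σ-list (map (λ k → Σ-list (map f (filterᵇ (p k) (x ∷ xs)))) (upTo N))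
      ≈⟨ Σ-cong (λ k → Σ-filterᵇ-∷ (p k) f x xs) (upTo N) ⟩
    Σ-list (map (λ k → (if κ x ≡ᵇ k then f x else 0#) + Σ-list (map f (filterᵇ (p k) xs))) (upTo N))
      ≈⟨ Σ-+ (λ k → if κ x ≡ᵇ k then f x else 0#) (λ k → Σ-list (map f (filterᵇ (p k) xs))) (upTo N) ⟩
    Σ-list (map (λ k → if κ x ≡ᵇ k then f x else 0#) (upTo N)) + Σ-list (map (λ k → Σ-list (map f (filterᵇ (p k) xs))) (upTo N))
      ≈⟨ +-cong (Σ-indicator (κ x) (f x) κx<N) (≈-sym (Σ-groupBy κ f xs κ<N)) ⟩
    f x + Σ-list (map f xs) ∎)
    where
      p : ℕ → _ → Bool
      p k a = κ a ≡ᵇ k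

  minor : ∀ {n} → (Fin (suc n) → Fin (suc n) → Carrier) → Fin (suc n) → Fin n → Fin n → Carrier
  minor M j i k = M (suc i) (punchIn j k)

  cofactorTerm : ∀ {n} → (Fin (suc n) → Fin (suc n) → Carrier) → Fin (suc n) → Carrier
  cofactorTerm {n} M j = (- 1#) ^ toℕ j * (M zero j * det n (minor M j))

  cofactorTerm-entry≈0 : ∀ {n} M (j : Fin (suc n)) → M zero j ≈ 0# → cofactorTerm M j ≈ 0#
  cofactorTerm-entry≈0 M j entry≈0 = ≈-trans (*-cong ≈-refl (≈-trans (*-cong entry≈0 ≈-refl) (zeroˡ _))) (zeroʳ _)

  cofactorTerm-minor≈0 : ∀ {n} M (j : Fin (suc n)) → det n (minor M j) ≈ 0# → cofactorTerm M j ≈ 0#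
  cofactorTerm-minor≈0 M j minor≈0 = ≈-trans (*-cong ≈-refl (≈-trans (*-cong ≈-refl minor≈0) (zeroʳ _))) (zeroʳ _)

  det-cong : ∀ n {M N : Fin n → Fin n → Carrier} → (∀ i j → M i j ≈ N i j) → det n M ≈ det n N
  det-cong zero M≈N = ≈-refl
  det-cong (suc n) M≈N =
    Σ-cong (λ j → *-cong ≈-refl (*-cong (M≈N zero j) (det-cong n (λ i k → M≈N (suc i) (punchIn j k))))) (allFin (suc n))

  det-zero-column : ∀ n M → (∀ i → M i zero ≈ 0#) → det (suc n) M ≈ 0#
  det-zero-column zero M col≈0 = Σ-zero {f = cofactorTerm M} (cofactorTerm-entry≈0 M zero (col≈0 zero) ∷ [])
  det-zero-column (suc n) M col≈0 = Σ-zero {f = cofactorTerm M} (cofactorTerm-entry≈0 M zero (col≈0 zero) ∷ tabulate⁺ λ j →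
    cofactorTerm-minor≈0 M (suc j) (det-zero-column n (minor M (suc j)) (λ i → col≈0 (suc i))))

  det-first-column : ∀ n M → (∀ i → M (suc i) zero ≈ 0#) → det (suc n) M ≈ M zero zero * det n (minor₀₀ M)
  det-first-column zero M _ = ≈-trans (+-identityʳ _) (*-identityˡ _)
  det-first-column (suc n) M col≈0 = ≈-trans (+-cong (*-identityˡ _) (Σ-zero {f = cofactorTerm M} (tabulate⁺ λ j →
    cofactorTerm-minor≈0 M (suc j) (det-zero-column n (minor M (suc j)) col≈0)))) (+-identityʳ _)

  det-band : ∀ n M → (∀ j → M zero (suc (suc j)) ≈ 0#) → (∀ i → M (suc (suc i)) zero ≈ 0#) →
    det (suc (suc n)) M ≈
    M zero zero * det (suc n) (minor₀₀ M) - (M zero (suc zero) * M (suc zero) zero) * det n (minor₀₀ (minor₀₀ M))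
  det-band n M row≈0 col≈0 =
    +-cong (*-identityˡ _)
      (≈-trans (+-cong second (Σ-zero {f = cofactorTerm M} (tabulate⁺ λ j → cofactorTerm-entry≈0 M (suc (suc j)) (row≈0 j))))
               (+-identityʳ _))
    where
      second : cofactorTerm M (suc zero) ≈ - ((M zero (suc zero) * M (suc zero) zero) * det n (minor₀₀ (minor₀₀ M)))
      second = begin
        ((- 1#) * 1#) * (M zero (suc zero) * det (suc n) (minor M (suc zero)))
          ≈⟨ *-cong (*-identityʳ _) (*-cong ≈-refl (det-first-column n (minor M (suc zero)) col≈0)) ⟩
        (- 1#) * (M zero (suc zero) * (M (suc zero) zero * det n (minor₀₀ (minor₀₀ M))))
          ≈⟨ -1*x≈-x _ ⟩
        - (M zero (suc zero) * (M (suc zero) zero * det n (minor₀₀ (minor₀₀ M))))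
          ≈⟨ -‿cong (≈-sym (*-assoc _ _ _)) ⟩
        - ((M zero (suc zero) * M (suc zero) zero) * det n (minor₀₀ (minor₀₀ M))) ∎

  -- The characteristic polynomial of a weighted path

  open SkewGain F using (adjMatrix; Ψ)

  charMatrix : ∀ n → (Fin n → Fin n → Carrier) → Carrier → Fin n → Fin n → Carrier
  charMatrix n φ x i j = (if i == j then x else 0#) - adjMatrix n φ i j

  charMatrix-minor₀₀ : ∀ m φ x (i j : Fin m) →
    charMatrix (suc m) φ x (suc i) (suc j) ≡ charMatrix m (minor₀₀ φ) x i j
  charMatrix-minor₀₀ m φ x i j =
    cong₂ (λ d a → (if d then x else 0#) - (if a then φ (suc i) (suc j) else 0#)) (==-suc i j) (adjacent-suc i j)

  charMatrix-off-band : ∀ {n} φ x (i j : Fin n) → (i == j) ≡ false → adjacent i j ≡ false → charMatrix n φ x i j ≈ 0#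
  charMatrix-off-band φ x i j i≢j i≁j =
    ≈-trans (≈-reflexive (cong₂ (λ d a → (if d then x else 0#) - (if a then φ i j else 0#)) i≢j i≁j)) (-‿inverseʳ 0#)

  x-0#≈x : ∀ x → x - 0# ≈ x
  x-0#≈x x = ≈-trans (+-cong ≈-refl -0#≈0#) (+-identityʳ x)

  [0-a][0-b]≈ab : ∀ a b → (0# - a) * (0# - b) ≈ a * b
  [0-a][0-b]≈ab a b = begin
    (0# - a) * (0# - b) ≈⟨ *-cong (+-identityˡ _) (+-identityˡ _) ⟩
    (- a) * (- b)       ≈⟨ ≈-sym (-‿distribˡ-* a (- b)) ⟩
    - (a * - b)         ≈⟨ -‿cong (≈-sym (-‿distribʳ-* a b)) ⟩
    - - (a * b)         ≈⟨ -‿involutive _ ⟩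
    a * b               ∎

  Ψ-suc-suc : ∀ m φ x → Ψ (suc (suc m)) φ x ≈
    x * Ψ (suc m) (minor₀₀ φ) x - (φ zero (suc zero) * φ (suc zero) zero) * Ψ m (minor₀₀ (minor₀₀ φ)) x
  Ψ-suc-suc m φ x = begin
    det (suc (suc m)) C
      ≈⟨ det-band m C (λ j → charMatrix-off-band φ x zero (suc (suc j)) refl (adjacent-zero-suc-suc m j))
                      (λ i → charMatrix-off-band φ x (suc (suc i)) zero refl (adjacent-suc-suc-zero m i)) ⟩
    C zero zero * det (suc m) (minor₀₀ C) - (C zero (suc zero) * C (suc zero) zero) * det m (minor₀₀ (minor₀₀ C))
      ≈⟨ +-cong (*-cong C₀₀≈x (det-cong (suc m) minor-C))
                (-‿cong (*-cong ([0-a][0-b]≈ab _ _) (det-cong m minor-minor-C))) ⟩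
    x * Ψ (suc m) (minor₀₀ φ) x - (φ zero (suc zero) * φ (suc zero) zero) * Ψ m (minor₀₀ (minor₀₀ φ)) x ∎
    where
      C : Fin (suc (suc m)) → Fin (suc (suc m)) → Carrier
      C = charMatrix (suc (suc m)) φ x
      C₀₀≈x : C zero zero ≈ x
      C₀₀≈x = ≈-trans (≈-reflexive (cong (λ a → x - (if a then φ zero zero else 0#)) (adjacent-zero-zero m))) (x-0#≈x x)
      minor-C : ∀ i j → minor₀₀ C i j ≈ charMatrix (suc m) (minor₀₀ φ) x i j
      minor-C i j = ≈-reflexive (charMatrix-minor₀₀ (suc m) φ x i j)
      minor-minor-C : ∀ i j → minor₀₀ (minor₀₀ C) i j ≈ charMatrix m (minor₀₀ (minor₀₀ φ)) x i j
      minor-minor-C i j = ≈-reflexive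
        (≡.trans (charMatrix-minor₀₀ (suc m) φ x (suc i) (suc j)) (charMatrix-minor₀₀ m (minor₀₀ φ) x i j))

  weight : ∀ {n} → (Fin n → Fin n → Carrier) → List (Fin n × Fin n) → Carrier
  weight w M = Π-list (map (λ e → w (proj₁ e) (proj₂ e)) M)

  weight-shiftEdge : ∀ {n} (w : Fin (suc n) → Fin (suc n) → Carrier) M →
    weight w (map shiftEdge M) ≡ weight (minor₀₀ w) M
  weight-shiftEdge w M = cong Π-list (≡.sym (map-∘ M))

  EdgeProducts : ∀ {n} → (Fin n → Fin n → Carrier) → (Fin n → Fin n → Carrier) → Set ℓ
  EdgeProducts φ w = ∀ i j → T (adjacent i j) → φ i j * φ j i ≈ w i j

  EdgeProducts-minor₀₀ : ∀ {n} {φ w : Fin (suc n) → Fin (suc n) → Carrier} →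
    EdgeProducts φ w → EdgeProducts (minor₀₀ φ) (minor₀₀ w)
  EdgeProducts-minor₀₀ φw i j i∼j = φw (suc i) (suc j) (≡.subst T (≡.sym (adjacent-suc i j)) i∼j)

  module _ (x : Carrier) where

    matchingTerm : ℕ → ℕ → Carrier → Carrier
    matchingTerm n k W = (- 1#) ^ k * (W * x ^ (n ∸ 2 ℕ.* k))

    monomial : ∀ n → (Fin n → Fin n → Carrier) → List (Fin n × Fin n) → Carrier
    monomial n w M = matchingTerm n (length M) (weight w M)

    matchingPolynomial : ∀ n → (Fin n → Fin n → Carrier) → Carrier
    matchingPolynomial n w = Σ-list (map (monomial n w) (allMatchings n))

    matchingTerm-suc : ∀ {n k} W → 2 ℕ.* k ≤ n → matchingTerm (suc n) k W ≈ x * matchingTerm n k W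
    matchingTerm-suc {n} {k} W 2k≤n = ≈-trans
      (≈-reflexive (cong (λ e → (- 1#) ^ k * (W * x ^ e)) (+-∸-assoc 1 2k≤n)))
      (≈-trans (*-cong ≈-refl (x∙yz≈y∙xz W x _)) (x∙yz≈y∙xz _ x _))

    matchingTerm-suc-suc : ∀ {n k} a W → matchingTerm (suc (suc n)) (suc k) (a * W) ≈ (- a) * matchingTerm n k W
    matchingTerm-suc-suc {n} {k} a W = begin
      ((- 1#) * s) * ((a * W) * x ^ (suc (suc n) ∸ 2 ℕ.* suc k))
        ≡⟨ cong (λ e → ((- 1#) * s) * ((a * W) * x ^ (suc (suc n) ∸ e))) (*-suc 2 k) ⟩
      ((- 1#) * s) * ((a * W) * X)  ≈⟨ *-assoc _ _ _ ⟩
      (- 1#) * (s * ((a * W) * X))  ≈⟨ -1*x≈-x _ ⟩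
      - (s * ((a * W) * X))         ≈⟨ -‿cong (≈-trans (*-cong ≈-refl (*-assoc a W X)) (x∙yz≈y∙xz s a _)) ⟩
      - (a * (s * (W * X)))         ≈⟨ -‿distribˡ-* a _ ⟩
      (- a) * (s * (W * X))         ∎
      where
        s X : Carrier
        s = (- 1#) ^ k
        X = x ^ (n ∸ 2 ℕ.* k)

    Σ-matchingTerm : ∀ {A : Set} n k (f : A → Carrier) xs →
      Σ-list (map (λ a → matchingTerm n k (f a)) xs) ≈ matchingTerm n k (Σ-list (map f xs))
    Σ-matchingTerm n k f xs = ≈-trans (Σ-*ˡ _ _ xs) (*-cong ≈-refl (Σ-*ʳ _ f xs))

    monomial-shiftEdge : ∀ {m} w (M : List (Fin (suc m) × Fin (suc m))) → 2 ℕ.* length M ≤ suc m →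
      monomial (suc (suc m)) w (map shiftEdge M) ≈ x * monomial (suc m) (minor₀₀ w) M
    monomial-shiftEdge w M 2|M|≤1+m = ≈-trans
      (≈-reflexive (cong₂ (matchingTerm _) (length-map shiftEdge M) (weight-shiftEdge w M)))
      (matchingTerm-suc {k = length M} (weight (minor₀₀ w) M) 2|M|≤1+m)

    monomial-edge₀₁ : ∀ {m} w (M : List (Fin m × Fin m)) →
      monomial (suc (suc m)) w (edge₀₁ ∷ map shiftEdge (map shiftEdge M)) ≈
      (- w zero (suc zero)) * monomial m (minor₀₀ (minor₀₀ w)) M
    monomial-edge₀₁ {m} w M = ≈-trans
      (≈-reflexive (cong₂ (λ k W → matchingTerm (suc (suc m)) (suc k) (w zero (suc zero) * W))
        (≡.trans (length-map shiftEdge (map shiftEdge M)) (length-map shiftEdge M))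
        (≡.trans (weight-shiftEdge w (map shiftEdge M)) (weight-shiftEdge (minor₀₀ w) M))))
      (matchingTerm-suc-suc {m} {length M} (w zero (suc zero)) (weight (minor₀₀ (minor₀₀ w)) M))

    matchingPolynomial-suc-suc : ∀ m w → matchingPolynomial (suc (suc m)) w ≈
      x * matchingPolynomial (suc m) (minor₀₀ w) - w zero (suc zero) * matchingPolynomial m (minor₀₀ (minor₀₀ w))
    matchingPolynomial-suc-suc m w = begin
      Σ-list (map t (allMatchings (suc (suc m))))
        ≡⟨ cong (Σ-list ∘ map t) (allMatchings-suc-suc m) ⟩
      Σ-list (map t (map (map shiftEdge) (allMatchings (suc m)) ++ map (edge₀₁ ∷_) twice))
        ≈⟨ Σ-map-++ t (map (map shiftEdge) (allMatchings (suc m))) (map (edge₀₁ ∷_) twice) ⟩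
      Σ-list (map t (map (map shiftEdge) (allMatchings (suc m)))) + Σ-list (map t (map (edge₀₁ ∷_) twice))
        ≈⟨ +-cong avoiding-edge₀₁ using-edge₀₁ ⟩
      x * matchingPolynomial (suc m) (minor₀₀ w) - w zero (suc zero) * matchingPolynomial m (minor₀₀ (minor₀₀ w)) ∎
      where
        t : List (Fin (suc (suc m)) × Fin (suc (suc m))) → Carrier
        t = monomial (suc (suc m)) w
        twice : List (List (Fin (suc (suc m)) × Fin (suc (suc m))))
        twice = map (map shiftEdge) (map (map shiftEdge) (allMatchings m))

        avoiding-edge₀₁ : Σ-list (map t (map (map shiftEdge) (allMatchings (suc m)))) ≈
                          x * matchingPolynomial (suc m) (minor₀₀ w)
        avoiding-edge₀₁ = begin
          Σ-list (map t (map (map shiftEdge) (allMatchings (suc m))))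
            ≡⟨ Σ-map t (map shiftEdge) (allMatchings (suc m)) ⟩
          Σ-list (map (t ∘ map shiftEdge) (allMatchings (suc m)))
            ≈⟨ Σ-congᴬ (All.map (λ {M} → monomial-shiftEdge w M) (allMatchings-size-bound (suc m))) ⟩
          Σ-list (map (λ M → x * monomial (suc m) (minor₀₀ w) M) (allMatchings (suc m)))
            ≈⟨ Σ-*ˡ x (monomial (suc m) (minor₀₀ w)) (allMatchings (suc m)) ⟩
          x * matchingPolynomial (suc m) (minor₀₀ w) ∎

        using-edge₀₁ : Σ-list (map t (map (edge₀₁ ∷_) twice)) ≈
                       - (w zero (suc zero) * matchingPolynomial m (minor₀₀ (minor₀₀ w)))
        using-edge₀₁ = begin
          Σ-list (map t (map (edge₀₁ ∷_) twice))
            ≡⟨ ≡.trans (Σ-map t (edge₀₁ ∷_) twice)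
                 (≡.trans (Σ-map (t ∘ (edge₀₁ ∷_)) (map shiftEdge) (map (map shiftEdge) (allMatchings m)))
                          (Σ-map (t ∘ (edge₀₁ ∷_) ∘ map shiftEdge) (map shiftEdge) (allMatchings m))) ⟩
          Σ-list (map (λ M → t (edge₀₁ ∷ map shiftEdge (map shiftEdge M))) (allMatchings m))
            ≈⟨ Σ-cong (monomial-edge₀₁ w) (allMatchings m) ⟩
          Σ-list (map (λ M → (- w zero (suc zero)) * monomial m (minor₀₀ (minor₀₀ w)) M) (allMatchings m))
            ≈⟨ Σ-*ˡ (- w zero (suc zero)) (monomial m (minor₀₀ (minor₀₀ w))) (allMatchings m) ⟩
          (- w zero (suc zero)) * matchingPolynomial m (minor₀₀ (minor₀₀ w))
            ≈⟨ ≈-sym (-‿distribˡ-* _ _) ⟩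
          - (w zero (suc zero) * matchingPolynomial m (minor₀₀ (minor₀₀ w))) ∎

    Ψ≈matchingPolynomial : ∀ n φ w → EdgeProducts φ w → Ψ n φ x ≈ matchingPolynomial n w
    Ψ≈matchingPolynomial zero φ w φw = ≈-sym (≈-trans (+-identityʳ _) (≈-trans (*-identityˡ _) (*-identityˡ _)))
    Ψ≈matchingPolynomial (suc zero) φ w φw =
      +-cong (*-cong ≈-refl (≈-trans (*-cong (x-0#≈x x) ≈-refl) (≈-sym (*-identityˡ _)))) ≈-refl
    Ψ≈matchingPolynomial (suc (suc m)) φ w φw = begin
      Ψ (suc (suc m)) φ x
        ≈⟨ Ψ-suc-suc m φ x ⟩
      x * Ψ (suc m) (minor₀₀ φ) x - (φ zero (suc zero) * φ (suc zero) zero) * Ψ m (minor₀₀ (minor₀₀ φ)) x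
        ≈⟨ +-cong (*-cong ≈-refl (Ψ≈matchingPolynomial (suc m) _ _ φ′w′))
                  (-‿cong (*-cong (φw zero (suc zero) tt) (Ψ≈matchingPolynomial m _ _ (EdgeProducts-minor₀₀ φ′w′)))) ⟩
      x * matchingPolynomial (suc m) (minor₀₀ w) - w zero (suc zero) * matchingPolynomial m (minor₀₀ (minor₀₀ w))
        ≈⟨ ≈-sym (matchingPolynomial-suc-suc m w) ⟩
      matchingPolynomial (suc (suc m)) w ∎
      where
        φ′w′ : EdgeProducts (minor₀₀ φ) (minor₀₀ w)
        φ′w′ = EdgeProducts-minor₀₀ φw

    matchingPolynomial-by-size : ∀ n w → matchingPolynomial n w ≈
      x ^ n + Σ-list (map (λ k → matchingTerm n k (Σ-list (map (weight w) (matchings n k)))) (map suc (upTo ⌊ n /2⌋)))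
    matchingPolynomial-by-size n w = begin
      Σ-list (map term (allMatchings n))
        ≈⟨ Σ-groupBy length term (allMatchings n) (All.map (s≤s ∘ 2*m≤n⇒m≤⌊n/2⌋) (allMatchings-size-bound n)) ⟩
      Σ-list (map bySize (upTo (suc ⌊ n /2⌋)))
        ≡⟨ cong (Σ-list ∘ map bySize) (upTo-suc ⌊ n /2⌋) ⟩
      bySize 0 + Σ-list (map bySize (map suc (upTo ⌊ n /2⌋)))
        ≈⟨ +-cong size-zero (Σ-cong size-k (map suc (upTo ⌊ n /2⌋))) ⟩
      x ^ n + Σ-list (map (λ k → matchingTerm n k (Σ-list (map (weight w) (matchings n k)))) (map suc (upTo ⌊ n /2⌋))) ∎
      where
        term : List (Fin n × Fin n) → Carrier
        term = monomial n w
        ofSize : ℕ → List (List (Fin n × Fin n))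
        ofSize k = filterᵇ (λ M → length M ≡ᵇ k) (allMatchings n)
        bySize : ℕ → Carrier
        bySize k = Σ-list (map term (ofSize k))

        size-zero : bySize 0 ≈ x ^ n
        size-zero = ≈-trans (≈-reflexive (cong (Σ-list ∘ map term) (allMatchings-size-zero n)))
                            (≈-trans (+-identityʳ _) (≈-trans (*-identityˡ _) (*-identityˡ _)))

        size-k : ∀ k → bySize k ≈ matchingTerm n k (Σ-list (map (weight w) (matchings n k)))
        size-k k = begin
          Σ-list (map term (ofSize k))
            ≈⟨ Σ-congᴬ (All.map (λ {M} |M|≡k → ≈-reflexive (cong (λ l → matchingTerm n l (weight w M)) (ℕₚ.≡ᵇ⇒≡ (length M) k |M|≡k)))
                                (all-filter (T? ∘ (λ M → length M ≡ᵇ k)) (allMatchings n))) ⟩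
          Σ-list (map (λ M → matchingTerm n k (weight w M)) (ofSize k))
            ≈⟨ Σ-matchingTerm n k (weight w) (ofSize k) ⟩
          matchingTerm n k (Σ-list (map (weight w) (ofSize k)))
            ≡⟨ cong (λ L → matchingTerm n k (Σ-list (map (weight w) L)))
                    (≡.sym (filterᵇ-∧ isMatching (λ M → length M ≡ᵇ k) (sublists (pathEdges n)))) ⟩
          matchingTerm n k (Σ-list (map (weight w) (matchings n k))) ∎

corollary2p2 : ∀ {c ℓ : Level} (F : Field c ℓ) → FieldOps.CharZero F →
    (f : FieldOps.AntiInvolution F) (n : ℕ) (φ : Fin n → Fin n → Field.Carrier F) →
    (∀ i j → T (adjacent i j) → ¬ (Field._≈_ F (φ i j) (Field.0# F))) →
    (∀ i j → T (adjacent i j) →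
      Field._≈_ F (φ j i) (FieldOps.AntiInvolution.fun f (φ i j))) →
    ∀ (x : Field.Carrier F) →
      Field._≈_ F (SkewGain.Ψ F n φ x) (SkewGain.rhs F f n φ x)
corollary2p2 F _ f n φ _ φ-skew x =
  ≈-trans (Ψ≈matchingPolynomial F x n φ g∘φ (λ i j i∼j → *-cong ≈-refl (φ-skew i j i∼j)))
          (matchingPolynomial-by-size F x n g∘φ)
  where
    open Field F using (Carrier; _*_; *-cong) renaming (refl to ≈-refl; trans to ≈-trans)
    g∘φ : Fin n → Fin n → Carrier
    g∘φ i j = φ i j * FieldOps.AntiInvolution.fun f (φ i j)
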